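{- Let $S$ be a finite non-synchronizing semigroup of singular transformations of a finite set, and let $I$ be its minimal ideal. Then $\mathrm{Gr}(I)=\mathrm{Gr}(S)$.
   Context: Transformations act on the right. A transformation is singular if it is not a permutation; a semigroup of transformations is synchronizing if it contains a transformation of rank $1$. The minimal ideal of a finite semigroup is its unique minimal two-sided ideal (for transformation semigroups, it consists of the elements of minimal rank). For a set $M$ of transformations of a finite set $V$, $\mathrm{Gr}(M)$ is the graph on $V$ in which distinct $v,w$ are adjacent iff there is no $f\in M$ with $vf=wf$. -}

module Defs where

open import Data.Nat using (ℕ)
open import Data.Fin using (Fin)
open import Data.Vec using (Vec; lookup; tabulate)
open import Data.Product using (Σ; ∃; _×_)
open import Relation.Nullary using (¬_)
open import Relation.Binary.PropositionalEquality using (_≡_; _≢_)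

-- A transformation of V = Fin n, stored as its table of images.
Trans : ℕ → Set
Trans n = Vec (Fin n) n

_∙_ : ∀ {n} → Fin n → Trans n → Fin n
v ∙ f = lookup f v

-- Product in the semigroup (act on the right):  v (f ⊙ g) = (v f) g.
_⊙_ : ∀ {n} → Trans n → Trans n → Trans n
f ⊙ g = tabulate (λ v → (v ∙ f) ∙ g)

-- A set of transformations, given as a predicate (automatically finite).
TSet : ℕ → Set₁
TSet n = Trans n → Set

_⊆_ : ∀ {n} → TSet n → TSet n → Set
A ⊆ B = ∀ f → A f → B f

IsPermutation : ∀ {n} → Trans n → Set
IsPermutation {n} f =
  (∀ v w → v ∙ f ≡ w ∙ f → v ≡ w) × (∀ (w : Fin n) → ∃ λ v → v ∙ f ≡ w)

Singular : ∀ {n} → Trans n → Set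
Singular f = ¬ IsPermutation f

-- Rank 1 (for n ≥ 1): constant transformation.
RankOne : ∀ {n} → Trans n → Set
RankOne {n} f = ∃ λ (c : Fin n) → ∀ v → v ∙ f ≡ c

IsSemigroup : ∀ {n} → TSet n → Set
IsSemigroup S = (∃ λ f → S f) × (∀ f g → S f → S g → S (f ⊙ g))

Synchronizing : ∀ {n} → TSet n → Set
Synchronizing S = ∃ λ f → S f × RankOne f

IsIdeal : ∀ {n} → TSet n → TSet n → Set
IsIdeal S J = (∃ λ f → J f) × (J ⊆ S)
  × (∀ s j → S s → J j → J (s ⊙ j)) × (∀ j s → J j → S s → J (j ⊙ s))

IsMinimalIdeal : ∀ {n} → TSet n → TSet n → Set₁
IsMinimalIdeal S I = IsIdeal S I × (∀ J → IsIdeal S J → J ⊆ I → I ⊆ J)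

GrAdj : ∀ {n} → TSet n → Fin n → Fin n → Set
GrAdj M v w = v ≢ w × ¬ (∃ λ f → M f × v ∙ f ≡ w ∙ f)

module Submission where

-- Adjacency is therefore antitone in M, and
-- since I ⊆ S every edge of Gr(S) is an edge of Gr(I).  Conversely, if some
-- s ∈ S collapses v and w, then so does s ⊙ j for any j ∈ I, because the
-- transformations act on the right; and s ⊙ j lies in I since I is an ideal.
-- Hence every edge of Gr(I) is an edge of Gr(S).
--
-- The argument only uses that I is a nonempty left ideal contained in S, so
-- it is proved for an arbitrary ideal (`GrAdj-ideal`); the theorem is the
-- special case of the minimal ideal.

open import Defs
open import Data.Nat using (ℕ)
open import Data.Fin using (Fin)
open import Data.Product using (_×_; _,_; ∃)
open import Relation.Nullary using (¬_)
open import Data.Vec.Properties using (lookup∘tabulate)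
open import Relation.Binary.PropositionalEquality using (_≡_; cong; module ≡-Reasoning)

act-⊙ : ∀ {n} (f g : Trans n) (v : Fin n) → v ∙ (f ⊙ g) ≡ (v ∙ f) ∙ g
act-⊙ f g v = lookup∘tabulate (λ u → (u ∙ f) ∙ g) v

collapse-⊙ʳ : ∀ {n} (f g : Trans n) {v w : Fin n}
  → v ∙ f ≡ w ∙ f → v ∙ (f ⊙ g) ≡ w ∙ (f ⊙ g)
collapse-⊙ʳ f g {v} {w} vf≡wf = begin
  v ∙ (f ⊙ g)   ≡⟨ act-⊙ f g v ⟩
  (v ∙ f) ∙ g   ≡⟨ cong (_∙ g) vf≡wf ⟩
  (w ∙ f) ∙ g   ≡⟨ act-⊙ f g w ⟨
  w ∙ (f ⊙ g)   ∎
  where open ≡-Reasoning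

GrAdj-antitone : ∀ {n} {M N : TSet n} → M ⊆ N
  → ∀ {v w : Fin n} → GrAdj N v w → GrAdj M v w
GrAdj-antitone M⊆N (v≢w , noN) = v≢w , λ { (f , Mf , eq) → noN (f , M⊆N f Mf , eq) }

-- A nonempty subset J with S J ⊆ J has no more edges than S: a collapse of
-- v, w by s ∈ S is transported into J by multiplying with some j ∈ J.
GrAdj-leftIdeal : ∀ {n} {S J : TSet n}
  → (∃ λ j → J j) → (∀ s j → S s → J j → J (s ⊙ j))
  → ∀ {v w : Fin n} → GrAdj J v w → GrAdj S v w
GrAdj-leftIdeal (j , Jj) left (v≢w , noJ) =
  v≢w , λ { (s , Ss , eq) → noJ (s ⊙ j , left s j Ss Jj , collapse-⊙ʳ s j eq) }

GrAdj-ideal : ∀ {n} {S J : TSet n} → IsIdeal S J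
  → ∀ (v w : Fin n) → (GrAdj J v w → GrAdj S v w) × (GrAdj S v w → GrAdj J v w)
GrAdj-ideal (nonempty , J⊆S , left , _) v w =
  GrAdj-leftIdeal nonempty left , GrAdj-antitone J⊆S

mainTheorem12 : ∀ (n : ℕ) (S I : TSet n)
    → IsSemigroup S
    → (∀ f → S f → Singular f)
    → ¬ Synchronizing S
    → IsMinimalIdeal S I
    → ∀ (v w : Fin n) → (GrAdj I v w → GrAdj S v w) × (GrAdj S v w → GrAdj I v w)
mainTheorem12 n S I _ _ _ (I-ideal , _) = GrAdj-ideal I-ideal
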